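{- Let $\pi\in\mathfrak{S}_n$ be indecomposable, $G=G_\pi$, $s\in[n]$ a sink, and $T$ a spanning tree of $G$ rooted at $s$. Then $$\mathrm{level}(\phi_{TC}(T))=\left|\{\{i,j\}\in E(G):h(i)=h(j)\}\right|+\left|\{\{i,j\}\in E(G):h(i)=h(j)-1\text{ and } i<p(j)\}\right|.$$
   Context: $G_\pi$: vertex set $[n]$, $a<b$ adjacent iff $b$ appears before $a$ in $\pi$; indecomposable: no $k<n$ with $\{\pi_1,\ldots,\pi_k\}=[k]$. For $T$ rooted at $s$: $h(i)$ is the distance from $i$ to $s$ in $T$, $p(j)$ the parent of $j\ne s$, $T^{(k)}=\{i:h(i)=k\}$, $N_G(i)$ the neighbours of $i$ in $G$. $\phi_{TC}(T)$ is the configuration $c$ with $c_i=\lambda_i+\mu_i+\nu_i$, where $\lambda_i=|N_G(i)\cap T^{(>h(i))}|$, $\mu_i=|N_G(i)\cap T^{(h(i))}|$, $\nu_i=|\{j\in N_G(i)\cap T^{(h(i)-1)}:j<p(i)\}|$ for $i\ne s$ and $\nu_s=0$. $\mathrm{level}(c)=\sum_i c_i-|E(G)|$. -}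

module Defs where

open import Data.Nat using (ℕ; zero; suc; _+_; _<_; _≤_)
import Data.Nat as ℕ
open import Data.Nat.Properties using (_≟_)
open import Data.Fin using (Fin; toℕ)
import Data.Fin as F
import Data.Fin.Properties as FP
open import Data.Fin.Permutation using (Permutation′; _⟨$⟩ʳ_; _⟨$⟩ˡ_)
open import Data.List using (List; length; filter; allFin; map)
open import Data.Nat.ListAction using (sum)
open import Data.Product using (_×_; Σ; _,_; ∃)
open import Data.Sum using (_⊎_)
open import Data.Integer using (ℤ; +_; _-_)
open import Relation.Binary.PropositionalEquality using (_≡_; _≢_)
open import Relation.Nullary using (¬_; Dec; yes; no)
open import Relation.Nullary.Decidable using (_×-dec_; _⊎-dec_)
open import Relation.Unary using (Decidable)

-- Vertices are Fin n (standing for [n]); the order on [n] is the order of Fin n.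
-- A permutation π ∈ S_n is given as a word: π_i = π ⟨$⟩ʳ i (position i ↦ value).
-- pos π a = position of the value a in the word π.
pos : ∀ {n} → Permutation′ n → Fin n → Fin n
pos π a = π ⟨$⟩ˡ a

-- Indecomposable: there is no k with 1 ≤ k < n and {π_1,…,π_k} = [k]
-- (positions with index < k carry exactly the values with index < k).
PrefixIsInitial : ∀ {n} → Permutation′ n → ℕ → Set
PrefixIsInitial {n} π k =
  ((i : Fin n) → toℕ i < k → toℕ (π ⟨$⟩ʳ i) < k) ×
  ((a : Fin n) → toℕ a < k → Σ (Fin n) λ i → toℕ i < k × π ⟨$⟩ʳ i ≡ a)

Indecomposable : ∀ {n} → Permutation′ n → Set
Indecomposable {n} π = (k : ℕ) → 1 ≤ k → k < n → ¬ PrefixIsInitial π k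

Adj : ∀ {n} → Permutation′ n → Fin n → Fin n → Set
Adj π a b = (a F.< b × pos π b F.< pos π a) ⊎ (b F.< a × pos π a F.< pos π b)

adj? : ∀ {n} (π : Permutation′ n) (a b : Fin n) → Dec (Adj π a b)
adj? π a b = ((a F.<? b) ×-dec (pos π b F.<? pos π a)) ⊎-dec ((b F.<? a) ×-dec (pos π a F.<? pos π b))

count : ∀ {n} {P : Fin n → Set} → Decidable P → ℕ
count {n} P? = length (filter P? (allFin n))

count₂ : ∀ {n} {R : Fin n → Fin n → Set} → ((i j : Fin n) → Dec (R i j)) → ℕ
count₂ {n} R? = sum (map (λ i → count (R? i)) (allFin n))

numEdges : ∀ {n} → Permutation′ n → ℕ
numEdges π = count₂ (λ a b → (a F.<? b) ×-dec adj? π a b)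

-- A spanning tree T of G_π rooted at s, given by its parent map p and its
-- height (distance-to-root) function h: the tree edges are {j , p j} for j ≠ s,
-- each an edge of G_π, and h s = 0, h j = h (p j) + 1 for j ≠ s.
-- (Every vertex reaches s by following p, since h strictly decreases; so the
-- n-1 edges {j , p j} form a spanning tree, and h is the distance to s in T.)
record RootedSpanningTree {n} (π : Permutation′ n) (s : Fin n) : Set where
  field
    parent        : Fin n → Fin n
    height        : Fin n → ℕ
    height-root   : height s ≡ 0
    height-parent : ∀ j → j ≢ s → height j ≡ suc (height (parent j))
    parent-adj    : ∀ j → j ≢ s → Adj π j (parent j)

module _ {n} (π : Permutation′ n) (s : Fin n) (T : RootedSpanningTree π s) where
  open RootedSpanningTree T renaming (parent to p; height to h)

  λc : Fin n → ℕ
  λc i = count (λ j → adj? π i j ×-dec (h i ℕ.<? h j))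

  μc : Fin n → ℕ
  μc i = count (λ j → adj? π i j ×-dec (h j ≟ h i))

  νc : Fin n → ℕ
  νc i with i F.≟ s
  ... | yes _ = 0
  ... | no  _ = count (λ j → adj? π i j ×-dec ((suc (h j) ≟ h i) ×-dec (j F.<? p i)))

  phiTC : Fin n → ℕ
  phiTC i = λc i + μc i + νc i

  sameLevelEdges : ℕ
  sameLevelEdges = count₂ (λ a b → (a F.<? b) ×-dec (adj? π a b ×-dec (h a ≟ h b)))

  -- |{{i,j} ∈ E(G) : h(i) = h(j) - 1 and i < p(j)}|  (heights differ, so each
  -- such edge has a unique labelling (i , j))
  nextLevelEdges : ℕ
  nextLevelEdges = count₂ (λ i j → adj? π i j ×-dec ((suc (h i) ≟ h j) ×-dec (i F.<? p j)))

level : ∀ {n} → Permutation′ n → (Fin n → ℕ) → ℤ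
level {n} π c = + sum (map c (allFin n)) - + numEdges π

-- Summing c over the vertices counts every ordered pair (i , j) of neighbours
-- with h(i) < h(j) or h(i) = h(j) (λ and μ), plus the pairs counted by ν.
-- An edge with distinct heights is thus counted once and an edge with equal
-- heights twice, so Σ (λ + μ) = |E(G)| + |same-level edges|; this is proved by
-- symmetrising the double sum over ordered pairs and comparing pair by pair.
-- The ν-sum is, after exchanging i and j, the count of next-level edges.
module Submission where

open import Defs
open import Data.Nat using (ℕ; _+_)
open import Data.Fin using (Fin)
open import Data.Fin.Permutation using (Permutation′)
open import Data.Integer using (ℤ; +_)
open import Relation.Binary.PropositionalEquality using (_≡_)

import Data.Fin as F
import Data.Fin.Properties as FP
import Data.Integer as ℤ
import Data.Integer.Properties as ℤ
open import Data.List using (List; []; _∷_; map; filter; length; allFin)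
open import Data.List.Properties using (map-cong)
open import Data.Nat using (suc; _*_; _∸_; _<?_)
import Data.Nat.Properties as ℕ
open import Algebra.Properties.CommutativeSemigroup ℕ.+-commutativeSemigroup using (interchange)
open import Data.Nat.ListAction using (sum)
open import Data.Nat.Tactic.RingSolver using (solve)
open import Data.Product using (_,_)
open import Data.Sum using (inj₁; inj₂)
open import Function using (_∘_)
open import Relation.Binary.Definitions using (Tri; tri<; tri≈; tri>)
open import Relation.Binary.PropositionalEquality using (refl; sym; trans; cong; cong₂; _≢_; module ≡-Reasoning)
open import Relation.Nullary using (Dec; yes; no; ¬_; contradiction)
open import Relation.Nullary.Decidable using (_×-dec_)
open import Relation.Unary using (Decidable)

private
  variable
    A : Set
    P Q R : Set

indicator : Dec P → ℕ
indicator (yes _) = 1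
indicator (no _)  = 0

indicator-yes : (P? : Dec P) → P → indicator P? ≡ 1
indicator-yes (yes _) _ = refl
indicator-yes (no ¬p) p = contradiction p ¬p

indicator-no : (P? : Dec P) → ¬ P → indicator P? ≡ 0
indicator-no (yes p) ¬p = contradiction p ¬p
indicator-no (no _)  _  = refl

indicator-⇔ : (P? : Dec P) (Q? : Dec Q) → (P → Q) → (Q → P) → indicator P? ≡ indicator Q?
indicator-⇔ (yes _) (yes _) _   _   = refl
indicator-⇔ (no _)  (no _)  _   _   = refl
indicator-⇔ (yes p) (no ¬q) p⇒q _   = contradiction (p⇒q p) ¬q
indicator-⇔ (no ¬p) (yes q) _   q⇒p = contradiction (q⇒p q) ¬p

indicator-× : (P? : Dec P) (Q? : Dec Q) → indicator (P? ×-dec Q?) ≡ indicator P? * indicator Q?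
indicator-× (yes _) (yes _) = refl
indicator-× (yes _) (no _)  = refl
indicator-× (no _)  _       = refl

indicator-×₃ : (P? : Dec P) (Q? : Dec Q) (R? : Dec R) →
  indicator (P? ×-dec (Q? ×-dec R?)) ≡ indicator P? * (indicator Q? * indicator R?)
indicator-×₃ P? Q? R? = trans (indicator-× P? (Q? ×-dec R?)) (cong (indicator P? *_) (indicator-× Q? R?))

indicator-tri : Tri P Q R → (P? : Dec P) (Q? : Dec Q) (R? : Dec R) →
  indicator P? + indicator Q? + indicator R? ≡ 1
indicator-tri (tri< p ¬q ¬r) P? Q? R?
  rewrite indicator-yes P? p | indicator-no Q? ¬q | indicator-no R? ¬r = refl
indicator-tri (tri≈ ¬p q ¬r) P? Q? R?
  rewrite indicator-no P? ¬p | indicator-yes Q? q | indicator-no R? ¬r = refl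
indicator-tri (tri> ¬p ¬q r) P? Q? R?
  rewrite indicator-no P? ¬p | indicator-no Q? ¬q | indicator-yes R? r = refl

indicator-*-guarded : (P? : Dec P) {m : ℕ} → (P → m ≡ 1) → indicator P? * m ≡ indicator P?
indicator-*-guarded (yes p) P⇒m≡1 = trans (ℕ.+-identityʳ _) (P⇒m≡1 p)
indicator-*-guarded (no _)  _     = refl

∑ : List A → (A → ℕ) → ℕ
∑ xs f = sum (map f xs)

∑-cong : (xs : List A) {f g : A → ℕ} → (∀ x → f x ≡ g x) → ∑ xs f ≡ ∑ xs g
∑-cong xs f≗g = cong sum (map-cong f≗g xs)

∑-0 : (xs : List A) → ∑ xs (λ _ → 0) ≡ 0
∑-0 []       = refl
∑-0 (_ ∷ xs) = ∑-0 xs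

∑-+ : (xs : List A) (f g : A → ℕ) → ∑ xs (λ x → f x + g x) ≡ ∑ xs f + ∑ xs g
∑-+ []       f g = refl
∑-+ (x ∷ xs) f g =
  trans (cong (_+_ (f x + g x)) (∑-+ xs f g)) (interchange (f x) (g x) (∑ xs f) (∑ xs g))

∑-comm : {B : Set} (xs : List A) (ys : List B) (f : A → B → ℕ) →
  ∑ xs (λ x → ∑ ys (f x)) ≡ ∑ ys (λ y → ∑ xs (λ x → f x y))
∑-comm []       ys f = sym (∑-0 ys)
∑-comm (x ∷ xs) ys f =
  trans (cong (_+_ (∑ ys (f x))) (∑-comm xs ys f)) (sym (∑-+ ys (f x) (λ y → ∑ xs (λ x′ → f x′ y))))

length-filter≡∑-indicator : {P : A → Set} (P? : Decidable P) (xs : List A) →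
  length (filter P? xs) ≡ ∑ xs (indicator ∘ P?)
length-filter≡∑-indicator P? []       = refl
length-filter≡∑-indicator P? (x ∷ xs) with P? x
... | yes _ = cong suc (length-filter≡∑-indicator P? xs)
... | no _  = length-filter≡∑-indicator P? xs

module DoubleSum (xs : List A) where

  ∑∑ : (A → A → ℕ) → ℕ
  ∑∑ f = ∑ xs (λ x → ∑ xs (f x))

  ∑∑-cong : {f g : A → A → ℕ} → (∀ x y → f x y ≡ g x y) → ∑∑ f ≡ ∑∑ g
  ∑∑-cong f≗g = ∑-cong xs (λ x → ∑-cong xs (f≗g x))

  ∑∑-+ : (f g : A → A → ℕ) → ∑∑ (λ x y → f x y + g x y) ≡ ∑∑ f + ∑∑ g
  ∑∑-+ f g = trans (∑-cong xs (λ x → ∑-+ xs (f x) (g x))) (∑-+ xs _ _)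

  ∑∑-transpose : (f : A → A → ℕ) → ∑∑ (λ x y → f y x) ≡ ∑∑ f
  ∑∑-transpose f = ∑-comm xs xs (λ x y → f y x)

  ∑∑-symmetrise : (f : A → A → ℕ) → ∑∑ f + ∑∑ f ≡ ∑∑ (λ x y → f x y + f y x)
  ∑∑-symmetrise f = trans (cong (_+_ (∑∑ f)) (sym (∑∑-transpose f))) (sym (∑∑-+ f _))

  ∑∑-cong-symmetrised : {f g : A → A → ℕ} →
    (∀ x y → f x y + f y x ≡ g x y + g y x) → ∑∑ f ≡ ∑∑ g
  ∑∑-cong-symmetrised {f} {g} f≗g = ℕ.*-cancelˡ-≡ (∑∑ f) (∑∑ g) 2 (begin
    2 * ∑∑ f                      ≡⟨ cong (_+_ (∑∑ f)) (ℕ.+-identityʳ (∑∑ f)) ⟩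
    ∑∑ f + ∑∑ f                   ≡⟨ ∑∑-symmetrise f ⟩
    ∑∑ (λ x y → f x y + f y x)    ≡⟨ ∑∑-cong f≗g ⟩
    ∑∑ (λ x y → g x y + g y x)    ≡⟨ sym (∑∑-symmetrise g) ⟩
    ∑∑ g + ∑∑ g                   ≡⟨ cong (_+_ (∑∑ g)) (sym (ℕ.+-identityʳ (∑∑ g))) ⟩
    2 * ∑∑ g                      ∎)
    where open ≡-Reasoning

module _ {n : ℕ} where

  count-× : {P Q : Fin n → Set} (P? : Decidable P) (Q? : Decidable Q) →
    count (λ j → P? j ×-dec Q? j) ≡ ∑ (allFin n) (λ j → indicator (P? j) * indicator (Q? j))
  count-× P? Q? =
    trans (length-filter≡∑-indicator (λ j → P? j ×-dec Q? j) (allFin n))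
      (∑-cong (allFin n) (λ j → indicator-× (P? j) (Q? j)))

  count-×₃ : {P Q R : Fin n → Set} (P? : Decidable P) (Q? : Decidable Q) (R? : Decidable R) →
    count (λ j → P? j ×-dec (Q? j ×-dec R? j)) ≡
    ∑ (allFin n) (λ j → indicator (P? j) * (indicator (Q? j) * indicator (R? j)))
  count-×₃ P? Q? R? =
    trans (length-filter≡∑-indicator (λ j → P? j ×-dec (Q? j ×-dec R? j)) (allFin n))
      (∑-cong (allFin n) (λ j → indicator-×₃ (P? j) (Q? j) (R? j)))

  Adj-sym : (π : Permutation′ n) {a b : Fin n} → Adj π a b → Adj π b a
  Adj-sym π (inj₁ a<b) = inj₂ a<b
  Adj-sym π (inj₂ b<a) = inj₁ b<a

  Adj⇒≢ : (π : Permutation′ n) {a b : Fin n} → Adj π a b → a ≢ b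
  Adj⇒≢ π (inj₁ (a<b , _)) refl = FP.<-irrefl refl a<b
  Adj⇒≢ π (inj₂ (b<a , _)) refl = FP.<-irrefl refl b<a

  indicator-<-total : (π : Permutation′ n) {a b : Fin n} → Adj π a b →
    indicator (a F.<? b) + indicator (b F.<? a) ≡ 1
  indicator-<-total π {a} {b} a~b = begin
    indicator (a F.<? b) + indicator (b F.<? a)
      ≡⟨ cong (_+ indicator (b F.<? a)) (sym (ℕ.+-identityʳ _)) ⟩
    indicator (a F.<? b) + 0 + indicator (b F.<? a)
      ≡⟨ cong (λ t → indicator (a F.<? b) + t + indicator (b F.<? a))
              (sym (indicator-no (a F.≟ b) (Adj⇒≢ π a~b))) ⟩
    indicator (a F.<? b) + indicator (a F.≟ b) + indicator (b F.<? a)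
      ≡⟨ indicator-tri (FP.<-cmp a b) (a F.<? b) (a F.≟ b) (b F.<? a) ⟩
    1 ∎
    where open ≡-Reasoning

-- Contribution of a pair of neighbours i, j: a = [i ~ j], lt/eq/gt compare
-- h(i) with h(j), and u, v are [i < j], [j < i].
edge-pair-identity : ∀ a lt eq gt u v → lt + eq + gt ≡ 1 → a * (u + v) ≡ a →
  a * lt + a * eq + (a * gt + a * eq) ≡ u * a + u * (a * eq) + (v * a + v * (a * eq))
edge-pair-identity a lt eq gt u v trichotomy total = begin
  a * lt + a * eq + (a * gt + a * eq)           ≡⟨ solve (a ∷ lt ∷ eq ∷ gt ∷ []) ⟩
  a * ((lt + eq + gt) + eq)                     ≡⟨ cong (λ t → a * (t + eq)) trichotomy ⟩
  a * (1 + eq)                                  ≡⟨ cong (_* (1 + eq)) (sym total) ⟩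
  a * (u + v) * (1 + eq)                        ≡⟨ solve (a ∷ u ∷ v ∷ eq ∷ []) ⟩
  u * a + u * (a * eq) + (v * a + v * (a * eq)) ∎
  where open ≡-Reasoning

+[m+n]-+m≡+n : ∀ m n → + (m + n) ℤ.- + m ≡ + n
+[m+n]-+m≡+n m n = begin
  + (m + n) ℤ.- + m  ≡⟨ ℤ.[+m]-[+n]≡m⊖n (m + n) m ⟩
  (m + n) ℤ.⊖ m      ≡⟨ ℤ.⊖-≥ (ℕ.m≤m+n m n) ⟩
  + (m + n ∸ m)      ≡⟨ cong +_ (ℕ.m+n∸m≡n m n) ⟩
  + n                ∎
  where open ≡-Reasoning

module _ {n : ℕ} (π : Permutation′ n) (s : Fin n) (T : RootedSpanningTree π s) where
  open RootedSpanningTree T renaming (parent to p; height to h)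
  open DoubleSum (allFin n)

  λ-term μ-term ν-term edge-term sameLevel-term nextLevel-term : Fin n → Fin n → ℕ
  λ-term i j = indicator (adj? π i j) * indicator (h i <? h j)
  μ-term i j = indicator (adj? π i j) * indicator (h j ℕ.≟ h i)
  ν-term i j = indicator (adj? π i j) * (indicator (suc (h j) ℕ.≟ h i) * indicator (j F.<? p i))
  edge-term i j = indicator (i F.<? j) * indicator (adj? π i j)
  sameLevel-term i j = indicator (i F.<? j) * (indicator (adj? π i j) * indicator (h i ℕ.≟ h j))
  nextLevel-term i j = indicator (adj? π i j) * (indicator (suc (h i) ℕ.≟ h j) * indicator (i F.<? p j))

  -- ν_s = 0 by definition, and the ν-terms of the root vanish since h(s) = 0.
  νc≡∑ν-term : ∀ i → νc π s T i ≡ ∑ (allFin n) (ν-term i)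
  νc≡∑ν-term i with i F.≟ s
  ... | yes refl = sym (trans (∑-cong (allFin n) ν-term-root≡0) (∑-0 (allFin n)))
    where
    ν-term-root≡0 : ∀ j → ν-term i j ≡ 0
    ν-term-root≡0 j = trans (sym (indicator-×₃ (adj? π i j) (suc (h j) ℕ.≟ h i) (j F.<? p i)))
      (indicator-no (adj? π i j ×-dec (suc (h j) ℕ.≟ h i ×-dec j F.<? p i)) (λ (_ , 1+hj≡hs , _) → ℕ.1+n≢0 (trans 1+hj≡hs height-root)))
  ... | no _ = count-×₃ (adj? π i) (λ j → suc (h j) ℕ.≟ h i) (λ j → j F.<? p i)

  sum-phiTC≡∑∑λμν : ∑ (allFin n) (phiTC π s T) ≡ ∑∑ λ-term + ∑∑ μ-term + ∑∑ ν-term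
  sum-phiTC≡∑∑λμν = begin
    ∑ (allFin n) (phiTC π s T)
      ≡⟨ ∑-cong (allFin n) (λ i → cong₂ _+_
           (cong₂ _+_ (count-× (adj? π i) (λ j → h i <? h j)) (count-× (adj? π i) (λ j → h j ℕ.≟ h i)))
           (νc≡∑ν-term i)) ⟩
    ∑ (allFin n) (λ i → ∑ (allFin n) (λ-term i) + ∑ (allFin n) (μ-term i) + ∑ (allFin n) (ν-term i))
      ≡⟨ ∑-+ (allFin n) _ _ ⟩
    ∑ (allFin n) (λ i → ∑ (allFin n) (λ-term i) + ∑ (allFin n) (μ-term i)) + ∑∑ ν-term
      ≡⟨ cong (_+ ∑∑ ν-term) (∑-+ (allFin n) _ _) ⟩
    ∑∑ λ-term + ∑∑ μ-term + ∑∑ ν-term ∎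
    where open ≡-Reasoning

  λμ-pair : ∀ i j → λ-term i j + μ-term i j + (λ-term j i + μ-term j i) ≡
                    edge-term i j + sameLevel-term i j + (edge-term j i + sameLevel-term j i)
  λμ-pair i j
    rewrite indicator-⇔ (adj? π j i) (adj? π i j) (Adj-sym π) (Adj-sym π)
          | indicator-⇔ (h j ℕ.≟ h i) (h i ℕ.≟ h j) sym sym
          = edge-pair-identity (indicator (adj? π i j))
              (indicator (h i <? h j)) (indicator (h i ℕ.≟ h j)) (indicator (h j <? h i))
              (indicator (i F.<? j)) (indicator (j F.<? i))
              (indicator-tri (ℕ.<-cmp (h i) (h j)) (h i <? h j) (h i ℕ.≟ h j) (h j <? h i))
              (indicator-*-guarded (adj? π i j) (indicator-<-total π))

  ∑∑λμ≡∑∑edge+sameLevel : ∑∑ λ-term + ∑∑ μ-term ≡ ∑∑ edge-term + ∑∑ sameLevel-term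
  ∑∑λμ≡∑∑edge+sameLevel =
    trans (sym (∑∑-+ λ-term μ-term)) (trans (∑∑-cong-symmetrised λμ-pair) (∑∑-+ edge-term sameLevel-term))

  ∑∑ν≡∑∑nextLevel : ∑∑ ν-term ≡ ∑∑ nextLevel-term
  ∑∑ν≡∑∑nextLevel = trans
    (∑∑-cong (λ i j → cong (_* _) (indicator-⇔ (adj? π i j) (adj? π j i) (Adj-sym π) (Adj-sym π))))
    (∑∑-transpose nextLevel-term)

  sum-phiTC : ∑ (allFin n) (phiTC π s T) ≡ numEdges π + (sameLevelEdges π s T + nextLevelEdges π s T)
  sum-phiTC = begin
    ∑ (allFin n) (phiTC π s T)                            ≡⟨ sum-phiTC≡∑∑λμν ⟩
    ∑∑ λ-term + ∑∑ μ-term + ∑∑ ν-term                     ≡⟨ cong₂ _+_ ∑∑λμ≡∑∑edge+sameLevel ∑∑ν≡∑∑nextLevel ⟩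
    ∑∑ edge-term + ∑∑ sameLevel-term + ∑∑ nextLevel-term  ≡⟨ ℕ.+-assoc (∑∑ edge-term) _ _ ⟩
    ∑∑ edge-term + (∑∑ sameLevel-term + ∑∑ nextLevel-term)
      ≡⟨ sym (cong₂ _+_ numEdges≡∑∑ (cong₂ _+_ sameLevelEdges≡∑∑ nextLevelEdges≡∑∑)) ⟩
    numEdges π + (sameLevelEdges π s T + nextLevelEdges π s T) ∎
    where
    open ≡-Reasoning
    numEdges≡∑∑ : numEdges π ≡ ∑∑ edge-term
    numEdges≡∑∑ = ∑-cong (allFin n) (λ i → count-× (i F.<?_) (adj? π i))
    sameLevelEdges≡∑∑ : sameLevelEdges π s T ≡ ∑∑ sameLevel-term
    sameLevelEdges≡∑∑ = ∑-cong (allFin n) (λ i → count-×₃ (i F.<?_) (adj? π i) (λ j → h i ℕ.≟ h j))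
    nextLevelEdges≡∑∑ : nextLevelEdges π s T ≡ ∑∑ nextLevel-term
    nextLevelEdges≡∑∑ =
      ∑-cong (allFin n) (λ i → count-×₃ (adj? π i) (λ j → suc (h i) ℕ.≟ h j) (λ j → i F.<? p j))

lemma3p9 : (n : ℕ) (π : Permutation′ n) → Indecomposable π →
    (s : Fin n) (T : RootedSpanningTree π s) →
    level π (phiTC π s T) ≡ + (sameLevelEdges π s T + nextLevelEdges π s T)
lemma3p9 n π _ s T = begin
  level π (phiTC π s T)                  ≡⟨ cong (λ t → + t ℤ.- + numEdges π) (sum-phiTC π s T) ⟩
  + (numEdges π + edgeCount) ℤ.- + numEdges π ≡⟨ +[m+n]-+m≡+n (numEdges π) edgeCount ⟩
  + edgeCount                            ∎
  where
  open ≡-Reasoning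
  edgeCount : ℕ
  edgeCount = sameLevelEdges π s T + nextLevelEdges π s T
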